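{- Let $M,M'$ be two max shuffles on $S_n$. Then for all $i\in\mathbb{N}$ and $w\in S_n$, $M^i(w)(1)=M'^i(w)(1)$.
   Context: $[n]=\{1,\dots,n\}$, $[a,b]=\{a,\dots,b\}$; $S_n$ is the group of bijections $[n]\to[n]$. A homing shuffle is a map $F:S_n\to S_n$ such that for every $w\in S_n$, setting $k:=w(1)$: (a) $F(w)(k)=k$, and (b) $F(w)(i)=w(i)$ for all $i>k$. A max shuffle is a homing shuffle $M$ such that for every $w\in S_n$ with $w(1)\neq1$, $M(w)(1)=\max(w([2,k]))$ where $k=w(1)$. $M^i$ denotes the $i$-th iterate. -}

module Defs where

open import Data.Nat using (ℕ; zero; suc; _≤_; _<_; _⊔_)
open import Data.Fin using (Fin; toℕ) renaming (zero to fz)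
open import Data.Fin.Permutation using (Permutation′; _⟨$⟩ʳ_)
open import Data.List using (List; foldr; map; filter)
open import Data.Nat.Properties using (_≤?_)
open import Data.Product using (_×_)
open import Relation.Nullary using (¬_)
open import Relation.Nullary.Decidable using (_×-dec_)
open import Relation.Binary.PropositionalEquality using (_≡_)
import Data.List as L

-- Positions/values are 0-indexed: the paper's value v ∈ [n] is the Fin
-- element with toℕ = v - 1.  Since the paper refers to w(1), we take
-- n = suc m (for n = 0 the statement is vacuous).

Perm : ℕ → Set
Perm n = Permutation′ n

app : ∀ {n} → Perm n → Fin n → Fin n
app w i = w ⟨$⟩ʳ i

iter : ∀ {A : Set} → ℕ → (A → A) → A → A
iter zero    f x = x
iter (suc i) f x = f (iter i f x)

IsHomingShuffle : ∀ {m} → (Perm (suc m) → Perm (suc m)) → Set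
IsHomingShuffle {m} F =
  ∀ (w : Perm (suc m)) →
    (app (F w) (app w fz) ≡ app w fz)
    × (∀ (i : Fin (suc m)) → toℕ (app w fz) < toℕ i → app (F w) i ≡ app w i)

-- max(w([2,k])) with k = w(1), as a 1-indexed natural number:
-- maximum over 0-indexed positions j with 1 ≤ toℕ j ≤ toℕ (w fz)
-- of the 1-indexed value suc (toℕ (w j)).  (The range is nonempty
-- whenever w(1) ≠ 1.)
maxPrefix : ∀ {m} → Perm (suc m) → ℕ
maxPrefix {m} w =
  foldr _⊔_ 0
    (map (λ j → suc (toℕ (app w j)))
      (filter (λ j → (1 ≤? toℕ j) ×-dec (toℕ j ≤? toℕ (app w fz))) (L.allFin (suc m))))

IsMaxShuffle : ∀ {m} → (Perm (suc m) → Perm (suc m)) → Set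
IsMaxShuffle {m} M =
  IsHomingShuffle M
  × (∀ (w : Perm (suc m)) → ¬ (app w fz ≡ fz) → suc (toℕ (app (M w) fz)) ≡ maxPrefix w)

-- Invariant: u and v have the same value k at position 1 and agree at every
-- position beyond k; it holds for (w, w) and is preserved by a step of M on u
-- and of M′ on v.  If k = 1 both shuffles fix position 1 and change nothing
-- beyond it.  Otherwise the new heads are max(u([2,k])) and max(v([2,k])),
-- equal because the values at positions 2..k form the complement of the
-- values at position 1 and beyond k.  These k − 1 values are distinct, so
-- the new head k′ is at least k − 1, and every position beyond k′ is either
-- k (fixed by both shuffles) or beyond k.
module Submission where

open import Defs
open import Data.Nat using (ℕ; zero; suc; _≤_; _<_; _⊔_; z≤n; s≤s; s≤s⁻¹)
open import Data.Nat.Properties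
  using (_≤?_; ≤-refl; ≤-trans; ≤-antisym; ⊔-lub; m⊔n≤o⇒m≤o; m⊔n≤o⇒n≤o;
         <-irrefl; ≮⇒≥; <⇒≱; n≢0⇒n>0; m≤n⇒m<n∨m≡n; suc-injective)
open import Data.Fin using (Fin; toℕ; fromℕ<; inject≤; _≟_) renaming (zero to fz; suc to fs)
open import Data.Fin.Properties
  using (toℕ-injective; toℕ<n; toℕ-inject≤; inject≤-injective; fromℕ<-injective; injective⇒≤)
import Data.Fin.Properties as Fin
open import Data.Fin.Permutation using (_⟨$⟩ˡ_; inverseˡ; inverseʳ)
open import Data.List using (List; foldr; allFin)
open import Data.List.Properties using (foldr-forcesᵇ; foldr-preservesᵇ)
open import Data.List.Relation.Unary.All using (All; lookup)
import Data.List.Relation.Unary.All as All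
open import Data.List.Relation.Unary.All.Properties using (all-filter; map⁺)
open import Data.List.Membership.Propositional using (_∈_)
open import Data.List.Membership.Propositional.Properties
  using (∈-allFin; ∈-map⁺; ∈-filter⁺)
open import Data.Product using (_×_; _,_; proj₁; proj₂)
open import Data.Sum using (inj₁; inj₂)
open import Relation.Nullary using (¬_; yes; no)
open import Relation.Nullary.Decidable using (_×-dec_)
open import Relation.Unary using (Decidable)
open import Relation.Binary.PropositionalEquality
  using (_≡_; _≢_; refl; sym; trans; cong; subst; module ≡-Reasoning)

≤-foldr-⊔ : ∀ {x} {xs : List ℕ} → x ∈ xs → x ≤ foldr _⊔_ 0 xs
≤-foldr-⊔ {xs = xs} x∈xs =
  lookup (foldr-forcesᵇ (λ x y x⊔y≤ → m⊔n≤o⇒m≤o x y x⊔y≤ , m⊔n≤o⇒n≤o x y x⊔y≤) 0 xs ≤-refl)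
         x∈xs

foldr-⊔-≤ : ∀ {b} {xs : List ℕ} → All (_≤ b) xs → foldr _⊔_ 0 xs ≤ b
foldr-⊔-≤ = foldr-preservesᵇ ⊔-lub z≤n

iter-preserves : ∀ {A : Set} {R : A → A → Set} {f g : A → A} →
                 (∀ {x y} → R x y → R (f x) (g y)) →
                 ∀ {x y} → R x y → ∀ i → R (iter i f x) (iter i g y)
iter-preserves step r zero    = r
iter-preserves {R = R} {f} {g} step {x} {y} r (suc i) =
  step {iter i f x} {iter i g y} (iter-preserves {R = R} step r i)

app-injective : ∀ {n} (w : Perm n) {i j} → app w i ≡ app w j → i ≡ j
app-injective w {i} {j} wi≡wj = begin
  i                      ≡⟨ sym (inverseˡ w) ⟩
  w ⟨$⟩ˡ app w i         ≡⟨ cong (w ⟨$⟩ˡ_) wi≡wj ⟩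
  w ⟨$⟩ˡ app w j         ≡⟨ inverseˡ w ⟩
  j                      ∎
  where open ≡-Reasoning

module _ {m : ℕ} where

  head : Perm (suc m) → Fin (suc m)
  head w = app w fz

  InPrefix : Perm (suc m) → Fin (suc m) → Set
  InPrefix w j = 1 ≤ toℕ j × toℕ j ≤ toℕ (head w)

  inPrefix? : ∀ w → Decidable (InPrefix w)
  inPrefix? w j = (1 ≤? toℕ j) ×-dec (toℕ j ≤? toℕ (head w))

  maxPrefix-upper : ∀ (w : Perm (suc m)) {j} → InPrefix w j →
                    suc (toℕ (app w j)) ≤ maxPrefix w
  maxPrefix-upper w {j} j∈ =
    ≤-foldr-⊔ (∈-map⁺ (λ i → suc (toℕ (app w i))) (∈-filter⁺ (inPrefix? w) (∈-allFin j) j∈))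

  maxPrefix-least : ∀ (w : Perm (suc m)) {b} →
                    (∀ j → InPrefix w j → suc (toℕ (app w j)) ≤ b) → maxPrefix w ≤ b
  maxPrefix-least w bound =
    foldr-⊔-≤ (map⁺ (All.map (bound _) (all-filter (inPrefix? w) (allFin (suc m)))))

  -- Pigeonhole: w is injective on the k positions of the prefix, and all their
  -- values lie below maxPrefix w.
  head≤maxPrefix : ∀ (w : Perm (suc m)) → toℕ (head w) ≤ maxPrefix w
  head≤maxPrefix w = injective⇒≤ {f = value} value-injective
    where
      k = toℕ (head w)

      k≤m : k ≤ m
      k≤m = s≤s⁻¹ (toℕ<n (head w))

      position : Fin k → Fin (suc m)
      position j = fs (inject≤ j k≤m)

      position-inPrefix : ∀ j → InPrefix w (position j)
      position-inPrefix j =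
        s≤s z≤n , subst (λ t → suc t ≤ k) (sym (toℕ-inject≤ j k≤m)) (toℕ<n j)

      value : Fin k → Fin (maxPrefix w)
      value j = fromℕ< (maxPrefix-upper w (position-inPrefix j))

      value-injective : ∀ {i j} → value i ≡ value j → i ≡ j
      value-injective {i} {j} eq =
        inject≤-injective k≤m k≤m i j (Fin.suc-injective (app-injective w (toℕ-injective
          (fromℕ<-injective _ _ (maxPrefix-upper w (position-inPrefix i))
                                (maxPrefix-upper w (position-inPrefix j)) eq))))

  record AgreeBeyondHead (u v : Perm (suc m)) : Set where
    constructor agreeBeyondHead
    field
      head-≡      : head u ≡ head v
      beyond-head : ∀ i → toℕ (head u) < toℕ i → app u i ≡ app v i

  agree-refl : ∀ {w} → AgreeBeyondHead w w
  agree-refl = agreeBeyondHead refl λ _ _ → refl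

  agree-sym : ∀ {u v} → AgreeBeyondHead u v → AgreeBeyondHead v u
  agree-sym (agreeBeyondHead u₀≡v₀ agree) =
    agreeBeyondHead (sym u₀≡v₀) λ i v₀<i →
      sym (agree i (subst (λ t → toℕ t < toℕ i) (sym u₀≡v₀) v₀<i))

  inPrefix-transport : ∀ {u v j} → AgreeBeyondHead u v → InPrefix u j →
                       InPrefix v (v ⟨$⟩ˡ app u j)
  inPrefix-transport {u} {v} {j} (agreeBeyondHead u₀≡v₀ agree) (1≤j , j≤u₀) =
    n≢0⇒n>0 p≢0 , ≮⇒≥ v₀≮p
    where
      p = v ⟨$⟩ˡ app u j

      p≡j : app u p ≡ app v p → p ≡ j
      p≡j up≡vp = app-injective u (trans up≡vp (inverseʳ v))

      p≢0 : toℕ p ≢ 0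
      p≢0 p≡0 =
        <-irrefl refl (subst (λ t → 1 ≤ toℕ t) (trans (sym (p≡j up≡vp)) p≡fz) 1≤j)
        where
          p≡fz = toℕ-injective {j = fz} p≡0
          up≡vp = trans (cong (app u) p≡fz) (trans u₀≡v₀ (cong (app v) (sym p≡fz)))

      v₀≮p : ¬ toℕ (head v) < toℕ p
      v₀≮p v₀<p =
        <⇒≱ v₀<p (subst (λ t → toℕ t ≤ toℕ (head v)) (sym (p≡j up≡vp)) j≤v₀)
        where
          up≡vp = agree p (subst (λ t → toℕ t < toℕ p) (sym u₀≡v₀) v₀<p)
          j≤v₀ = subst (λ t → toℕ j ≤ toℕ t) u₀≡v₀ j≤u₀

  maxPrefix-mono : ∀ {u v} → AgreeBeyondHead u v → maxPrefix u ≤ maxPrefix v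
  maxPrefix-mono {u} {v} u≈v = maxPrefix-least u λ j j∈ →
    subst (λ t → suc (toℕ t) ≤ maxPrefix v) (inverseʳ v)
          (maxPrefix-upper v (inPrefix-transport u≈v j∈))

  maxPrefix-cong : ∀ {u v} → AgreeBeyondHead u v → maxPrefix u ≡ maxPrefix v
  maxPrefix-cong u≈v = ≤-antisym (maxPrefix-mono u≈v) (maxPrefix-mono (agree-sym u≈v))

  homing-agree-from-head : ∀ (F F′ : Perm (suc m) → Perm (suc m)) →
                           IsHomingShuffle F → IsHomingShuffle F′ →
                           ∀ {u v} → AgreeBeyondHead u v →
                           ∀ i → toℕ (head u) ≤ toℕ i → app (F u) i ≡ app (F′ v) i
  homing-agree-from-head F F′ homF homF′ {u} {v} (agreeBeyondHead u₀≡v₀ agree) i u₀≤i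
    with m≤n⇒m<n∨m≡n u₀≤i
  ... | inj₁ u₀<i = begin
    app (F u) i   ≡⟨ proj₂ (homF u) i u₀<i ⟩
    app u i       ≡⟨ agree i u₀<i ⟩
    app v i       ≡˘⟨ proj₂ (homF′ v) i (subst (λ t → toℕ t < toℕ i) u₀≡v₀ u₀<i) ⟩
    app (F′ v) i  ∎
    where open ≡-Reasoning
  ... | inj₂ u₀≡i with toℕ-injective u₀≡i
  ... | refl = begin
    app (F u) (head u)   ≡⟨ proj₁ (homF u) ⟩
    head u               ≡⟨ u₀≡v₀ ⟩
    head v               ≡⟨ sym (proj₁ (homF′ v)) ⟩
    app (F′ v) (head v)  ≡⟨ cong (app (F′ v)) (sym u₀≡v₀) ⟩
    app (F′ v) (head u)  ∎
    where open ≡-Reasoning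

  homing-head-fz : ∀ (F : Perm (suc m) → Perm (suc m)) → IsHomingShuffle F →
                   ∀ w → head w ≡ fz → head (F w) ≡ fz
  homing-head-fz F homF w w₀≡0 = subst (λ t → app (F w) t ≡ t) w₀≡0 (proj₁ (homF w))

  maxShuffle-head-bound : ∀ (M : Perm (suc m) → Perm (suc m)) → IsMaxShuffle M →
                          ∀ u → toℕ (head u) ≤ suc (toℕ (head (M u)))
  maxShuffle-head-bound M (_ , maxM) u with head u ≟ fz
  ... | yes u₀≡0 = subst (λ t → toℕ t ≤ suc (toℕ (head (M u)))) (sym u₀≡0) z≤n
  ... | no u₀≢0  = subst (toℕ (head u) ≤_) (sym (maxM u u₀≢0)) (head≤maxPrefix u)

  maxShuffle-head-cong : ∀ (M M′ : Perm (suc m) → Perm (suc m)) →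
                         IsMaxShuffle M → IsMaxShuffle M′ →
                         ∀ {u v} → AgreeBeyondHead u v → head (M u) ≡ head (M′ v)
  maxShuffle-head-cong M M′ (homM , maxM) (homM′ , maxM′) {u} {v}
                       u≈v@(agreeBeyondHead u₀≡v₀ _) with head u ≟ fz
  ... | yes u₀≡0 =
    trans (homing-head-fz M homM u u₀≡0)
          (sym (homing-head-fz M′ homM′ v (trans (sym u₀≡v₀) u₀≡0)))
  ... | no u₀≢0 = toℕ-injective (suc-injective (begin
    suc (toℕ (head (M u)))   ≡⟨ maxM u u₀≢0 ⟩
    maxPrefix u              ≡⟨ maxPrefix-cong u≈v ⟩
    maxPrefix v              ≡˘⟨ maxM′ v (λ v₀≡0 → u₀≢0 (trans u₀≡v₀ v₀≡0)) ⟩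
    suc (toℕ (head (M′ v)))  ∎))
    where open ≡-Reasoning

  maxShuffle-preserves-agree : ∀ (M M′ : Perm (suc m) → Perm (suc m)) →
                               IsMaxShuffle M → IsMaxShuffle M′ →
                               ∀ {u v} → AgreeBeyondHead u v → AgreeBeyondHead (M u) (M′ v)
  maxShuffle-preserves-agree M M′ maxM maxM′ {u} u≈v =
    agreeBeyondHead (maxShuffle-head-cong M M′ maxM maxM′ u≈v) λ i Mu₀<i →
      homing-agree-from-head M M′ (proj₁ maxM) (proj₁ maxM′) u≈v i
        (≤-trans (maxShuffle-head-bound M maxM u) Mu₀<i)

corollary2 : ∀ {m : ℕ} (M M′ : Perm (suc m) → Perm (suc m)) →
    IsMaxShuffle M → IsMaxShuffle M′ →
    ∀ (i : ℕ) (w : Perm (suc m)) → app (iter i M w) fz ≡ app (iter i M′ w) fz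
corollary2 M M′ maxM maxM′ i _ =
  AgreeBeyondHead.head-≡
    (iter-preserves {R = AgreeBeyondHead} {M} {M′}
                    (maxShuffle-preserves-agree M M′ maxM maxM′) agree-refl i)
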